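{- Let $A$ be a finite set of atoms. The set of all Krom theories over $A$ is a subnear-semiring of $(\mathcal H_A,\cup,\circ,\emptyset)$ (i.e. it contains $\emptyset$ and is closed under $\cup$ and $\circ$). Moreover, Krom theories distribute from the left: for every Krom theory $K$ and all propositional Horn theories $P,R$ over $A$, $$K\circ(P\cup R)=(K\circ P)\cup(K\circ R).$$ Consequently, the set of proper Krom theories over $A$ forms a finite idempotent semiring with respect to $\cup$ and $\circ$ (with zero $\emptyset$).
   Context: A theory over a finite alphabet $A$ is a finite set of rules $a_0\leftarrow a_1,\ldots,a_k$ ($k\ge0$, $a_i\in A$), with $head(r)=\{a_0\}$, $body(r)=\{a_1,\ldots,a_k\}$, size of $r$ equal to $k$; $head(S),body(S)$ are unions over a set $S$ of rules. $\mathcal H_A$ denotes the set of all theories over $A$. A fact is a rule with empty body; a proper rule is a rule that is not a fact. A rule is Krom if it has at most one body atom; a theory is Krom if all its rules are Krom; a proper Krom theory is a Krom theory all of whose rules have exactly one body atom. Write $S\subseteq_r R$ if $S\subseteq R$ has as many elements as the size of $r$. Composition: $P\circ R=\{head(r)\leftarrow body(S)\mid r\in P,\ S\subseteq_r R,\ head(S)=body(r)\}$. A near-semiring is $(S,+,\cdot,0)$ with $(S,+,0)$ a monoid, $(S,\cdot)$ a semigroup, $(x+y)z=xz+yz$ and $0x=0$; idempotent means $x+x=x$. A semiring is a near-semiring in which $+$ is commutative and additionally $x(y+z)=xy+xz$ and $x0=0$ for all $x,y,z$. -}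

module Defs where

open import Data.Nat using (ℕ; _≤_; _≟_)
open import Data.Bool using (Bool)
open import Data.Fin using (Fin)
import Data.Fin.Properties as FinP
open import Data.Fin.Subset using (Subset; ⁅_⁆; ⋃; ∣_∣)
open import Data.Product using (_×_; _,_; proj₁; proj₂; ∃)
open import Data.List using (List; []; _∷_; _++_; map; filter; concatMap; length)
open import Data.List.Membership.Propositional using (_∈_)
open import Data.List.Relation.Unary.All using (All)
open import Data.List.Relation.Unary.Unique.Propositional using (Unique)
import Data.List.Relation.Unary.Unique.DecPropositional as UDec
import Data.Vec.Properties as VecP
import Data.Product.Properties as ProdP
import Data.Bool.Properties as BoolP
open import Relation.Binary.Definitions using (DecidableEquality)
open import Relation.Binary.PropositionalEquality using (_≡_)
open import Relation.Nullary.Decidable using (_×-dec_)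
open import Function.Bundles using (_⇔_)

-- The finite alphabet A is modelled as Fin n.
-- A rule a₀ ← a₁,…,a_k : a head atom and a body which is a SET of atoms.
Rule : ℕ → Set
Rule n = Fin n × Subset n

headR : ∀ {n} → Rule n → Fin n
headR = proj₁

bodyR : ∀ {n} → Rule n → Subset n
bodyR = proj₂

size : ∀ {n} → Rule n → ℕ
size r = ∣ bodyR r ∣

_≟R_ : ∀ {n} → DecidableEquality (Rule n)
_≟R_ = ProdP.≡-dec FinP._≟_ (VecP.≡-dec BoolP._≟_)

-- A theory is a finite set of rules, represented by a list; two theories are
-- the same theory iff they have the same elements (set equality _≈_ below).
Theory : ℕ → Set
Theory n = List (Rule n)

infix 4 _≈_
_≈_ : ∀ {n} → Theory n → Theory n → Set
P ≈ Q = ∀ r → (r ∈ P) ⇔ (r ∈ Q)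

∅ : ∀ {n} → Theory n
∅ = []

infixl 6 _∪_
_∪_ : ∀ {n} → Theory n → Theory n → Theory n
_∪_ = _++_

heads : ∀ {n} → List (Rule n) → Subset n
heads S = ⋃ (map (λ r → ⁅ headR r ⁆) S)

bodies : ∀ {n} → List (Rule n) → Subset n
bodies S = ⋃ (map bodyR S)

subsequences : ∀ {a} {X : Set a} → List X → List (List X)
subsequences []       = [] ∷ []
subsequences (x ∷ xs) = let ss = subsequences xs in ss ++ map (x ∷_) ss

-- S ⊆_r R  together with  head(S) = body(r):  S is a subset of R (a duplicate-free
-- subsequence of R) with exactly size(r) elements and head(S) = body(r).
Admissible : ∀ {n} → Rule n → List (Rule n) → Set
Admissible r S = (length S ≡ size r) × Unique S × (heads S ≡ bodyR r)

admissible? : ∀ {n} (r : Rule n) (S : List (Rule n)) → Relation.Nullary.Decidable.Dec (Admissible r S)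
admissible? r S = (length S ≟ size r) ×-dec (UDec.unique? _≟R_ S ×-dec VecP.≡-dec BoolP._≟_ (heads S) (bodyR r))

infixl 7 _∘_
_∘_ : ∀ {n} → Theory n → Theory n → Theory n
P ∘ R = concatMap (λ r → map (λ S → (headR r , bodies S))
                              (filter (admissible? r) (subsequences R))) P

KromRule : ∀ {n} → Rule n → Set
KromRule r = size r ≤ 1

Krom : ∀ {n} → Theory n → Set
Krom P = All KromRule P

ProperKrom : ∀ {n} → Theory n → Set
ProperKrom P = All (λ r → size r ≡ 1) P

-- For a Krom rule r an admissible S ⊆ R has at most one element, so {r} ∘ R is
-- {r} if r is a fact and {head(r) ← body(s) | s ∈ R, head(s) = body(r)} otherwise.
-- With this description every law is a pointwise argument on rules: it is monotone
-- in R and splits over unions (left distributivity, congruence), one-step resolvents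
-- compose (associativity), and a proper rule has no resolvent against ∅ (right zero).
-- Right distributivity holds for all theories, as ∘ is computed rule by rule on the
-- left. Finiteness: each theory is set-equal to a sublist of the list of all rules.

module Submission where

open import Defs
open import Data.Nat using (ℕ)
open import Data.Product using (_×_; ∃)
open import Data.List using (List)
open import Data.List.Relation.Unary.Any using (Any)

open import Algebra.Bundles using (CommutativeMonoid)
open import Data.Bool using (true; false)
open import Data.Empty using (⊥-elim)
open import Data.Fin using (Fin)
import Data.Fin.Subset as Subset
open import Data.Fin.Subset using (Subset; ⁅_⁆; ∣_∣) renaming (⊥ to ∅ₛ)
open import Data.Fin.Subset.Properties using (∣⊥∣≡0; ∣⁅x⁆∣≡1; x∈⁅x⁆; ∉⊥)
  renaming (∪-identityʳ to ∪ₛ-identityʳ)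
open import Data.List using ([]; _∷_; _++_; [_]; map; filter; concatMap; cartesianProduct; allFin)
open import Data.List.Properties using (concatMap-++)
open import Data.List.Relation.Unary.Any using (here; there)
open import Data.List.Relation.Unary.All using ([]; _∷_)
import Data.List.Relation.Unary.All as All
import Data.List.Relation.Unary.All.Properties as All
open import Data.List.Relation.Unary.AllPairs using ([]; _∷_)
open import Data.List.Membership.Propositional using (_∈_; find; lose)
open import Data.List.Membership.Propositional.Properties
import Data.List.Membership.DecPropositional as DecMembership
open import Data.List.Relation.Binary.Subset.Propositional using (_⊆_)
open import Data.List.Relation.Binary.Subset.Propositional.Properties
  using (⊆-refl; ∷⁺ʳ; xs⊆x∷xs; xs⊆xs++ys; xs⊆ys++xs)
open import Data.List.Relation.Binary.BagAndSetEquality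
  using (_∼[_]_; set; commutativeMonoid; ++-idempotent)
open import Data.Nat using (_≤_; z≤n; s≤s; zero; suc)
open import Data.Nat.Properties using (≤-reflexive; 0≢1+n)
open import Data.Product using (_,_; proj₂)
open import Data.Sum using (_⊎_; inj₁; inj₂; [_,_]′)
open import Data.Vec using ([]; _∷_)
open import Function using (_∘′_)
open import Function.Bundles using (mk⇔; Equivalence)
open import Relation.Binary.PropositionalEquality using (_≡_; _≢_; refl; sym; trans; cong; subst)
open import Relation.Nullary using (¬_; does)
open import Relation.Unary using (Decidable)

module _ {a} {A : Set a} where

  []∈subsequences : (xs : List A) → [] ∈ subsequences xs
  []∈subsequences []       = here refl
  []∈subsequences (x ∷ xs) = ∈-++⁺ˡ ([]∈subsequences xs)

  [x]∈subsequences : ∀ {x} {xs : List A} → x ∈ xs → [ x ] ∈ subsequences xs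
  [x]∈subsequences {xs = y ∷ ys} (here refl) =
    ∈-++⁺ʳ (subsequences ys) (∈-map⁺ (y ∷_) ([]∈subsequences ys))
  [x]∈subsequences {xs = y ∷ ys} (there x∈ys) = ∈-++⁺ˡ ([x]∈subsequences x∈ys)

  ∈-subsequences⇒⊆ : ∀ {S xs : List A} → S ∈ subsequences xs → S ⊆ xs
  ∈-subsequences⇒⊆ {xs = []} (here refl) ()
  ∈-subsequences⇒⊆ {xs = x ∷ xs} S∈ with ∈-++⁻ (subsequences xs) S∈
  ... | inj₁ S∈xs = xs⊆x∷xs xs x ∘′ ∈-subsequences⇒⊆ S∈xs
  ... | inj₂ S∈x∷xs with ∈-map⁻ (x ∷_) S∈x∷xs
  ...   | T , T∈xs , refl = ∷⁺ʳ x (∈-subsequences⇒⊆ T∈xs)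

  filter∈subsequences : ∀ {p} {P : A → Set p} (P? : Decidable P) (xs : List A) →
                        filter P? xs ∈ subsequences xs
  filter∈subsequences P? []       = here refl
  filter∈subsequences P? (x ∷ xs) with does (P? x)
  ... | false = ∈-++⁺ˡ (filter∈subsequences P? xs)
  ... | true  = ∈-++⁺ʳ (subsequences xs) (∈-map⁺ (x ∷_) (filter∈subsequences P? xs))

allSubsets : ∀ n → List (Subset n)
allSubsets zero    = [] ∷ []
allSubsets (suc n) = map (true ∷_) (allSubsets n) ++ map (false ∷_) (allSubsets n)

∈-allSubsets : ∀ {n} (p : Subset n) → p ∈ allSubsets n
∈-allSubsets []          = here refl
∈-allSubsets (true ∷ p)  = ∈-++⁺ˡ (∈-map⁺ (true ∷_) (∈-allSubsets p))
∈-allSubsets (false ∷ p) = ∈-++⁺ʳ _ (∈-map⁺ (false ∷_) (∈-allSubsets p))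

allRules : ∀ n → List (Rule n)
allRules n = cartesianProduct (allFin n) (allSubsets n)

∈-allRules : ∀ {n} (r : Rule n) → r ∈ allRules n
∈-allRules (i , p) = ∈-cartesianProduct⁺ (∈-allFin i) (∈-allSubsets p)

⁅x⁆≢⊥ : ∀ {n} (i : Fin n) → ⁅ i ⁆ ≢ ∅ₛ
⁅x⁆≢⊥ i e = ∉⊥ (subst (i Subset.∈_) e (x∈⁅x⁆ i))

module _ {n : ℕ} where

  ⊆-antisym : {P Q : Theory n} → P ⊆ Q → Q ⊆ P → P ≈ Q
  ⊆-antisym P⊆Q Q⊆P _ = mk⇔ P⊆Q Q⊆P

  ≈⇒⊆ : {P Q : Theory n} → P ≈ Q → P ⊆ Q
  ≈⇒⊆ P≈Q = Equivalence.to (P≈Q _)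

  ≈⇒⊇ : {P Q : Theory n} → P ≈ Q → Q ⊆ P
  ≈⇒⊇ P≈Q = Equivalence.from (P≈Q _)

  ≈-reflexive : {P Q : Theory n} → P ≡ Q → P ≈ Q
  ≈-reflexive refl = ⊆-antisym ⊆-refl ⊆-refl

  private
    module ∪-SetEquality = CommutativeMonoid (commutativeMonoid set (Rule n))

    ∼⇒≈ : {P Q : Theory n} → P ∼[ set ] Q → P ≈ Q
    ∼⇒≈ P∼Q _ = P∼Q

    ≈⇒∼ : {P Q : Theory n} → P ≈ Q → P ∼[ set ] Q
    ≈⇒∼ P≈Q = P≈Q _

  ∪-assoc : (P Q R : Theory n) → (P ∪ Q) ∪ R ≈ P ∪ (Q ∪ R)
  ∪-assoc P Q R = ∼⇒≈ (∪-SetEquality.assoc P Q R)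

  ∪-comm : (P Q : Theory n) → P ∪ Q ≈ Q ∪ P
  ∪-comm P Q = ∼⇒≈ (∪-SetEquality.comm P Q)

  ∪-idem : (P : Theory n) → P ∪ P ≈ P
  ∪-idem P = ∼⇒≈ (++-idempotent P)

  ∪-identityˡ : (P : Theory n) → ∅ ∪ P ≈ P
  ∪-identityˡ P = ∼⇒≈ (∪-SetEquality.identityˡ P)

  ∪-identityʳ : (P : Theory n) → P ∪ ∅ ≈ P
  ∪-identityʳ P = ∼⇒≈ (∪-SetEquality.identityʳ P)

  ∪-cong : {P P′ R R′ : Theory n} → P ≈ P′ → R ≈ R′ → P ∪ R ≈ P′ ∪ R′
  ∪-cong P≈P′ R≈R′ = ∼⇒≈ (∪-SetEquality.∙-cong (≈⇒∼ P≈P′) (≈⇒∼ R≈R′))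

  -- The elements of [ r ] ∘ R when r is a Krom rule (see ∈-∘⁺ and ∈-∘⁻).
  data Resolvent (r : Rule n) (R : Theory n) : Rule n → Set where
    fact  : ∅ₛ ≡ bodyR r → Resolvent r R (headR r , ∅ₛ)
    chain : ∀ {s} → s ∈ R → ⁅ headR s ⁆ ≡ bodyR r → Resolvent r R (headR r , bodyR s)

  private
    resolvents : Theory n → Rule n → Theory n
    resolvents R r = map (λ S → (headR r , bodies S)) (filter (admissible? r) (subsequences R))

  heads-[x] : (s : Rule n) → heads [ s ] ≡ ⁅ headR s ⁆
  heads-[x] s = ∪ₛ-identityʳ ⁅ headR s ⁆

  bodies-[x] : (s : Rule n) → bodies [ s ] ≡ bodyR s
  bodies-[x] s = ∪ₛ-identityʳ (bodyR s)

  fact-size≡0 : {r : Rule n} → ∅ₛ ≡ bodyR r → size r ≡ 0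
  fact-size≡0 {r} ∅≡body = trans (cong ∣_∣ (sym ∅≡body)) (∣⊥∣≡0 n)

  ∈-∘⁺ : ∀ {P R : Theory n} {r x} → r ∈ P → Resolvent r R x → x ∈ P ∘ R
  ∈-∘⁺ {P} {R} {r} r∈P resolvent = ∈-concatMap⁺ (resolvents R) (lose r∈P
    (∈-map∘filter⁺ (λ S → (headR r , bodies S)) (admissible? r) (witness resolvent)))
    where
    witness : ∀ {x} → Resolvent r R x →
              ∃ λ S → S ∈ subsequences R × x ≡ (headR r , bodies S) × Admissible r S
    witness (fact ∅≡body) =
      [] , []∈subsequences R , refl , sym (fact-size≡0 {r} ∅≡body) , [] , ∅≡body
    witness (chain {s} s∈R head≡body) =
      [ s ] , [x]∈subsequences s∈R , cong (headR r ,_) (sym (bodies-[x] s)) ,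
      trans (sym (∣⁅x⁆∣≡1 (headR s))) (cong ∣_∣ head≡body) , [] ∷ [] ,
      trans (heads-[x] s) head≡body

  admissible⇒Resolvent : ∀ {r : Rule n} {R S} → KromRule r → S ⊆ R → Admissible r S →
                         Resolvent r R (headR r , bodies S)
  admissible⇒Resolvent {S = []} _ _ (_ , _ , heads≡body) = fact heads≡body
  admissible⇒Resolvent {r} {R} {S = s ∷ []} _ S⊆R (_ , _ , heads≡body) =
    subst (Resolvent r R) (cong (headR r ,_) (sym (bodies-[x] s)))
      (chain (S⊆R (here refl)) (trans (sym (heads-[x] s)) heads≡body))
  admissible⇒Resolvent {S = _ ∷ _ ∷ _} krom _ (length≡size , _)
    with subst (_≤ 1) (sym length≡size) krom
  ... | s≤s ()

  ∈-∘⁻ : ∀ {P R : Theory n} {x} → Krom P → x ∈ P ∘ R → ∃ λ r → r ∈ P × Resolvent r R x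
  ∈-∘⁻ {P} {R} krom x∈P∘R with find (∈-concatMap⁻ (resolvents R) {xs = P} x∈P∘R)
  ... | r , r∈P , x∈r∘R with ∈-map∘filter⁻ (λ S → (headR r , bodies S)) (admissible? r) x∈r∘R
  ... | S , S∈subsequences , refl , admissible =
    r , r∈P , admissible⇒Resolvent (All.lookup krom r∈P) (∈-subsequences⇒⊆ S∈subsequences)
                                   admissible

  Resolvent-mono : ∀ {r : Rule n} {R R′ x} → R ⊆ R′ → Resolvent r R x → Resolvent r R′ x
  Resolvent-mono R⊆R′ (fact ∅≡body)         = fact ∅≡body
  Resolvent-mono R⊆R′ (chain s∈R head≡body) = chain (R⊆R′ s∈R) head≡body

  Resolvent-++⁻ : ∀ {r : Rule n} R {R′ x} → Resolvent r (R ++ R′) x →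
                  Resolvent r R x ⊎ Resolvent r R′ x
  Resolvent-++⁻ R (fact ∅≡body) = inj₁ (fact ∅≡body)
  Resolvent-++⁻ R (chain s∈R++R′ head≡body) with ∈-++⁻ R s∈R++R′
  ... | inj₁ s∈R  = inj₁ (chain s∈R head≡body)
  ... | inj₂ s∈R′ = inj₂ (chain s∈R′ head≡body)

  Resolvent-∘⁺ : ∀ {p : Rule n} {Q R y x} → Resolvent p Q y → Resolvent y R x →
                 Resolvent p (Q ∘ R) x
  Resolvent-∘⁺ (fact ∅≡body) (fact _)            = fact ∅≡body
  Resolvent-∘⁺ (fact _)      (chain {s} _ head≡∅) = ⊥-elim (⁅x⁆≢⊥ (headR s) head≡∅)
  Resolvent-∘⁺ {R = R} (chain q∈Q q↦p) (fact ∅≡body) =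
    chain (∈-∘⁺ {R = R} q∈Q (fact ∅≡body)) q↦p
  Resolvent-∘⁺ {R = R} (chain q∈Q q↦p) (chain s∈R s↦q) =
    chain (∈-∘⁺ {R = R} q∈Q (chain s∈R s↦q)) q↦p

  Resolvent-∘⁻ : ∀ {p : Rule n} {Q R x} → Krom Q → Resolvent p (Q ∘ R) x →
                 ∃ λ y → Resolvent p Q y × Resolvent y R x
  Resolvent-∘⁻ _ (fact ∅≡body) = _ , fact ∅≡body , fact refl
  Resolvent-∘⁻ kromQ (chain z∈Q∘R z↦p) with ∈-∘⁻ kromQ z∈Q∘R
  ... | q , q∈Q , fact ∅≡body    = _ , chain q∈Q z↦p , fact ∅≡body
  ... | q , q∈Q , chain s∈R s↦q = _ , chain q∈Q z↦p , chain s∈R s↦q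

  Krom-∘ : {P R : Theory n} → Krom P → Krom R → Krom (P ∘ R)
  Krom-∘ {R = R} kromP kromR = All.tabulate λ x∈P∘R →
    let _ , _ , resolvent = ∈-∘⁻ kromP x∈P∘R in size≤1 resolvent
    where
    size≤1 : ∀ {r x} → Resolvent r R x → KromRule x
    size≤1 (fact _)      = subst (_≤ 1) (sym (∣⊥∣≡0 n)) z≤n
    size≤1 (chain s∈R _) = All.lookup kromR s∈R

  ProperKrom⇒Krom : {P : Theory n} → ProperKrom P → Krom P
  ProperKrom⇒Krom = All.map ≤-reflexive

  proper⇒¬fact : {r : Rule n} → size r ≡ 1 → ¬ (∅ₛ ≡ bodyR r)
  proper⇒¬fact {r} size≡1 ∅≡body = 0≢1+n (trans (sym (fact-size≡0 {r} ∅≡body)) size≡1)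

  ProperKrom-∘ : {P R : Theory n} → ProperKrom P → ProperKrom R → ProperKrom (P ∘ R)
  ProperKrom-∘ {P} {R} properP properR = All.tabulate λ x∈P∘R →
    let r , r∈P , resolvent = ∈-∘⁻ (ProperKrom⇒Krom properP) x∈P∘R in size≡1 r∈P resolvent
    where
    size≡1 : ∀ {r x} → r ∈ P → Resolvent r R x → size x ≡ 1
    size≡1 {r} r∈P (fact ∅≡body) = ⊥-elim (proper⇒¬fact {r} (All.lookup properP r∈P) ∅≡body)
    size≡1 _       (chain s∈R _) = All.lookup properR s∈R

  ∘-mono : {P P′ R R′ : Theory n} → Krom P → P ⊆ P′ → R ⊆ R′ → P ∘ R ⊆ P′ ∘ R′
  ∘-mono krom P⊆P′ R⊆R′ x∈P∘R with ∈-∘⁻ krom x∈P∘R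
  ... | r , r∈P , resolvent = ∈-∘⁺ (P⊆P′ r∈P) (Resolvent-mono R⊆R′ resolvent)

  ∘-cong : {P P′ R R′ : Theory n} → Krom P → Krom P′ → P ≈ P′ → R ≈ R′ → P ∘ R ≈ P′ ∘ R′
  ∘-cong kromP kromP′ P≈P′ R≈R′ =
    ⊆-antisym (∘-mono kromP (≈⇒⊆ P≈P′) (≈⇒⊆ R≈R′)) (∘-mono kromP′ (≈⇒⊇ P≈P′) (≈⇒⊇ R≈R′))

  ∘-distribˡ-∪ : (K P R : Theory n) → Krom K → K ∘ (P ∪ R) ≈ (K ∘ P) ∪ (K ∘ R)
  ∘-distribˡ-∪ K P R krom = ⊆-antisym split merge
    where
    split : K ∘ (P ∪ R) ⊆ (K ∘ P) ∪ (K ∘ R)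
    split x∈ with ∈-∘⁻ krom x∈
    ... | r , r∈K , resolvent with Resolvent-++⁻ P resolvent
    ...   | inj₁ r↦P = ∈-++⁺ˡ (∈-∘⁺ r∈K r↦P)
    ...   | inj₂ r↦R = ∈-++⁺ʳ (K ∘ P) (∈-∘⁺ r∈K r↦R)
    merge : (K ∘ P) ∪ (K ∘ R) ⊆ K ∘ (P ∪ R)
    merge = [ ∘-mono krom ⊆-refl (xs⊆xs++ys P R) , ∘-mono krom ⊆-refl (xs⊆ys++xs R P) ]′
              ∘′ ∈-++⁻ (K ∘ P)

  ∘-distribʳ-∪ : (P Q R : Theory n) → (P ∪ Q) ∘ R ≈ (P ∘ R) ∪ (Q ∘ R)
  ∘-distribʳ-∪ P Q R = ≈-reflexive (concatMap-++ (resolvents R) P Q)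

  ∘-assoc : (P Q R : Theory n) → Krom P → Krom Q → (P ∘ Q) ∘ R ≈ P ∘ (Q ∘ R)
  ∘-assoc P Q R kromP kromQ = ⊆-antisym to from
    where
    to : (P ∘ Q) ∘ R ⊆ P ∘ (Q ∘ R)
    to x∈ with ∈-∘⁻ {R = R} (Krom-∘ kromP kromQ) x∈
    ... | y , y∈P∘Q , y↦x with ∈-∘⁻ {R = Q} kromP y∈P∘Q
    ...   | p , p∈P , p↦y = ∈-∘⁺ p∈P (Resolvent-∘⁺ {R = R} p↦y y↦x)
    from : P ∘ (Q ∘ R) ⊆ (P ∘ Q) ∘ R
    from x∈ with ∈-∘⁻ {R = Q ∘ R} kromP x∈
    ... | p , p∈P , p↦x with Resolvent-∘⁻ {R = R} kromQ p↦x
    ...   | y , p↦y , y↦x = ∈-∘⁺ (∈-∘⁺ {R = Q} p∈P p↦y) y↦x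

  ∘-zeroʳ : (P : Theory n) → ProperKrom P → P ∘ ∅ ≈ ∅
  ∘-zeroʳ P proper = ⊆-antisym noResolvent λ ()
    where
    noResolvent : P ∘ ∅ ⊆ ∅
    noResolvent x∈ with ∈-∘⁻ {R = ∅} (ProperKrom⇒Krom proper) x∈
    ... | r , r∈P , fact ∅≡body = ⊥-elim (proper⇒¬fact {r} (All.lookup proper r∈P) ∅≡body)
    ... | _ , _ , chain () _

  theories-finite : (P : Theory n) → Any (P ≈_) (subsequences (allRules n))
  theories-finite P = lose (filter∈subsequences (_∈? P) (allRules n))
                           (⊆-antisym (λ r∈P → ∈-filter⁺ (_∈? P) (∈-allRules _) r∈P)
                                      (λ r∈ → proj₂ (∈-filter⁻ (_∈? P) {xs = allRules n} r∈)))
    where open DecMembership _≟R_ using (_∈?_)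

theorem3p3 : (n : ℕ) →
    (Krom {n} ∅
      × (∀ (P R : Theory n) → Krom P → Krom R → Krom (P ∪ R))
      × (∀ (P R : Theory n) → Krom P → Krom R → Krom (P ∘ R)))
    × (∀ (K P R : Theory n) → Krom K → K ∘ (P ∪ R) ≈ (K ∘ P) ∪ (K ∘ R))
    × ((ProperKrom {n} ∅
        × (∀ (P R : Theory n) → ProperKrom P → ProperKrom R → ProperKrom (P ∪ R))
        × (∀ (P R : Theory n) → ProperKrom P → ProperKrom R → ProperKrom (P ∘ R)))
      × (∀ (P P′ R R′ : Theory n) → ProperKrom P → ProperKrom P′ → ProperKrom R → ProperKrom R′ →
           P ≈ P′ → R ≈ R′ → (P ∪ R ≈ P′ ∪ R′) × (P ∘ R ≈ P′ ∘ R′))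
      × (∀ (P Q R : Theory n) → ProperKrom P → ProperKrom Q → ProperKrom R →
           ((P ∪ Q) ∪ R ≈ P ∪ (Q ∪ R)) × (P ∪ Q ≈ Q ∪ P) × (P ∪ P ≈ P)
           × (∅ ∪ P ≈ P) × (P ∪ ∅ ≈ P))
      × (∀ (P Q R : Theory n) → ProperKrom P → ProperKrom Q → ProperKrom R →
           ((P ∘ Q) ∘ R ≈ P ∘ (Q ∘ R))
           × ((P ∪ Q) ∘ R ≈ (P ∘ R) ∪ (Q ∘ R))
           × (P ∘ (Q ∪ R) ≈ (P ∘ Q) ∪ (P ∘ R))
           × (∅ ∘ P ≈ ∅) × (P ∘ ∅ ≈ ∅))
      × (∃ λ (L : List (Theory n)) → ∀ (P : Theory n) → ProperKrom P → Any (P ≈_) L))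
theorem3p3 n =
  ([] , (λ _ _ → All.++⁺) , (λ _ _ → Krom-∘))
  , ∘-distribˡ-∪
  , ( ([] , (λ _ _ → All.++⁺) , (λ _ _ → ProperKrom-∘))
    , (λ P P′ R R′ properP properP′ _ _ P≈P′ R≈R′ →
         ∪-cong P≈P′ R≈R′ , ∘-cong (ProperKrom⇒Krom properP) (ProperKrom⇒Krom properP′) P≈P′ R≈R′)
    , (λ P Q R _ _ _ → ∪-assoc P Q R , ∪-comm P Q , ∪-idem P , ∪-identityˡ P , ∪-identityʳ P)
    , (λ P Q R properP properQ _ →
         ∘-assoc P Q R (ProperKrom⇒Krom properP) (ProperKrom⇒Krom properQ)
         , ∘-distribʳ-∪ P Q R , ∘-distribˡ-∪ P Q R (ProperKrom⇒Krom properP)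
         , ≈-reflexive refl , ∘-zeroʳ P properP)
    , (subsequences (allRules n) , λ P _ → theories-finite P))
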